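{- For every non-negative integer $N$, \[\sum_{\pi\in\mathcal{D}_{\le N}} (-1)^{\mathcal{O}(\pi)} q^{\mathcal{E}(\pi)} = \begin{cases}(-q;q^2)_{N/2}, & N \text{ even},\\ 0, & N\text{ odd},\end{cases}\qquad \sum_{\pi\in\mathcal{P}_{\le N}} (-1)^{\mathcal{O}(\pi)} q^{\mathcal{E}(\pi)} = \begin{cases}\dfrac{1}{(q^2;q^2)_{N/2}}, & N \text{ even},\\ 0, & N\text{ odd}.\end{cases}\]
   Context: A partition $\pi=(\lambda_1,\lambda_2,\dots)$ is a finite non-increasing sequence of positive integers; the empty sequence is the unique partition of $0$. $\mathcal{P}_{\le N}$ is the set of partitions with all parts $\le N$, $\mathcal{D}_{\le N}$ the set of partitions into distinct parts all $\le N$. $\mathcal{O}(\pi)=\lambda_1+\lambda_3+\cdots$, $\mathcal{E}(\pi)=\lambda_2+\lambda_4+\cdots$. $(a;q)_l=\prod_{i=0}^{l-1}(1-aq^i)$. Identities of formal power series in $q$. -}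

module Defs where

open import Data.Nat as ℕ using (ℕ; zero; suc; _≤_; _<_; _≥_; _>_; _∸_)
open import Data.Integer as ℤ using (ℤ)
open import Data.List using (List; []; _∷_; map; upTo; foldr)
open import Data.List.Relation.Unary.All using (All)
open import Data.List.Relation.Unary.Linked using (Linked)
open import Data.List.Relation.Unary.Unique.Propositional using (Unique)
open import Data.List.Membership.Propositional using (_∈_)
open import Data.Product using (Σ; _×_)
open import Function.Bundles using (_⇔_)
open import Relation.Binary.PropositionalEquality using (_≡_)

-- Partitions: finite non-increasing lists of positive integers,
-- written (λ₁, λ₂, …) with λ₁ first.

IsPartition : List ℕ → Set
IsPartition π = Linked _≥_ π × All (0 <_) π

InP : ℕ → List ℕ → Set
InP N π = IsPartition π × All (_≤ N) π

InD : ℕ → List ℕ → Set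
InD N π = InP N π × Linked _>_ π

-- 𝒪(π) = λ₁ + λ₃ + ⋯ ,  ℰ(π) = λ₂ + λ₄ + ⋯
mutual
  𝒪 : List ℕ → ℕ
  𝒪 []       = 0
  𝒪 (x ∷ xs) = x ℕ.+ ℰ xs

  ℰ : List ℕ → ℕ
  ℰ []       = 0
  ℰ (x ∷ xs) = 𝒪 xs

sumℤ : List ℤ → ℤ
sumℤ = foldr ℤ._+_ ℤ.0ℤ

sign : List ℕ → ℤ
sign π = (ℤ.- ℤ.1ℤ) ℤ.^ 𝒪 π

-- Finite sums over a set of partitions given by a predicate:
-- "Σ_{π ∈ S} (-1)^{𝒪(π)} = c" means S is finite, enumerated without
-- repetition by some list L, and the sum over L is c.

SignSumIs : (List ℕ → Set) → ℤ → Set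
SignSumIs S c =
  Σ (List (List ℕ)) λ L →
    Unique L × (∀ π → (π ∈ L) ⇔ S π) × (sumℤ (map sign L) ≡ c)

FPS : Set
FPS = ℕ → ℤ

_≈_ : FPS → FPS → Set
f ≈ g = ∀ n → f n ≡ g n

𝟘 : FPS
𝟘 _ = ℤ.0ℤ

𝟙 : FPS
𝟙 zero    = ℤ.1ℤ
𝟙 (suc _) = ℤ.0ℤ

q : FPS
q 1 = ℤ.1ℤ
q _ = ℤ.0ℤ

_⊕_ : FPS → FPS → FPS
(f ⊕ g) n = f n ℤ.+ g n

⊖_ : FPS → FPS
(⊖ f) n = ℤ.- f n

_⊗_ : FPS → FPS → FPS
(f ⊗ g) n = sumℤ (map (λ i → f i ℤ.* g (n ∸ i)) (upTo (suc n)))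

_^^_ : FPS → ℕ → FPS
f ^^ zero  = 𝟙
f ^^ suc k = f ⊗ (f ^^ k)

prodFPS : ℕ → (ℕ → FPS) → FPS
prodFPS l F = foldr (λ i acc → F i ⊗ acc) 𝟙 (upTo l)

poch : FPS → FPS → ℕ → FPS
poch a b l = prodFPS l (λ i → 𝟙 ⊕ (⊖ (a ⊗ (b ^^ i))))

-- generating function Σ_{π ∈ S} (-1)^{𝒪(π)} q^{ℰ(π)}, coefficientwise:
-- the coefficient of q^k is the signed count of π ∈ S with ℰ(π) = k
-- (each such set is finite for the sets used here).
IsGenFun : (List ℕ → Set) → FPS → Set
IsGenFun S f = ∀ k → SignSumIs (λ π → S π × ℰ π ≡ k) (f k)

{-# OPTIONS --safe #-}
module Submission where

-- Removing the largest part x of a partition swaps the two statistics: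
-- 𝒪(x ∷ π) = x + ℰ(π) and ℰ(x ∷ π) = 𝒪(π). So F_N = Σ (-1)^𝒪 q^ℰ is tracked together
-- with its dual G_N = Σ (-1)^ℰ q^𝒪. Splitting off the partitions whose largest part is N gives,
-- for distinct parts,
--   F_N = F_{N-1} + (-1)^N G_{N-1},   G_N = G_{N-1} + q^N F_{N-1},
-- and for unrestricted parts the same with F_N, G_N in place of F_{N-1}, G_{N-1} in the
-- second summands. Induction on N by parity then gives F_{2m} = G_{2m} = (-q;q²)_m and
-- F_{2m+1} = 0 for distinct parts; for unrestricted parts F_{2m+1} = -q^{2m+1} F_{2m+1}
-- forces F_{2m+1} = 0, and F_{2m} = F_{2m-2} + q^{2m} F_{2m} gives F_{2m} (q²;q²)_m = 1.

open import Defs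
open import Data.Nat as ℕ using (ℕ; zero; suc; _≤_; _<_; _∸_; z≤n; s≤s; z<s; _%_; _/_)
import Data.Nat.Properties as ℕ
open import Data.Nat.DivMod using (m≡m%n+[m/n]*n)
open import Data.Nat.GeneralisedArithmetic using (fold)
open import Data.Nat.Induction using (<-rec)
open import Data.Integer using (ℤ; 0ℤ; 1ℤ; -1ℤ; _+_; _*_; -_; _^_)
open import Data.Integer.Properties
  using (+-identityˡ; +-identityʳ; +-assoc; +-inverseʳ; *-identityˡ; *-identityʳ; *-zeroˡ; *-zeroʳ
        ; *-distribˡ-+; *-distribʳ-+; neg-involutive; neg-distrib-+; neg-distribˡ-*; neg-distribʳ-*
        ; -1*i≡-i; ^-distribˡ-+-*)
open import Data.Integer.Tactic.RingSolver using (solve-∀)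
open import Data.List using (List; []; _∷_; map; upTo; foldr; _++_; [_]; _∷ʳ_)
open import Data.List.Properties
  using ( ∷-injectiveʳ; map-++; map-∘; map-cong; map-cong-local; map-upTo; map-applyUpTo
        ; upTo-∷ʳ; foldr-∷ʳ)
open import Data.List.Membership.Propositional using (_∈_)
open import Data.List.Membership.Propositional.Properties using (∈-++⁺ˡ; ∈-++⁺ʳ; ∈-++⁻; ∈-map⁺; ∈-map⁻)
open import Data.List.Relation.Unary.All as All using (All; []; _∷_)
open import Data.List.Relation.Unary.All.Properties using (applyUpTo⁺₁)
open import Data.List.Relation.Unary.AllPairs using ([]; _∷_)
open import Data.List.Relation.Unary.Any using (here; there)
open import Data.List.Relation.Unary.Linked as Linked using (Linked; []; [-]; _∷_)
open import Data.List.Relation.Unary.Linked.Properties using (Linked⇒All)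
open import Data.List.Relation.Unary.Unique.Propositional using (Unique)
import Data.List.Relation.Unary.Unique.Propositional.Properties as Unique
open import Data.Empty using (⊥; ⊥-elim)
open import Data.Product using (Σ; _×_; _,_; proj₁; proj₂)
open import Data.Sum as Sum using (_⊎_; inj₁; inj₂)
open import Function.Bundles using (_⇔_; mk⇔; module Equivalence)
open import Function.Construct.Composition using (_⇔-∘_)
open import Relation.Binary.Bundles using (Setoid)
import Relation.Binary.Reasoning.Setoid as SetoidReasoning
open import Relation.Binary.Properties.Poset ℕ.≤-poset using (≥-trans)
open import Relation.Binary.Properties.StrictPartialOrder ℕ.<-strictPartialOrder using (>-trans)
open import Relation.Binary.PropositionalEquality
  using (_≡_; refl; sym; trans; cong; cong₂; subst; module ≡-Reasoning)
open import Relation.Nullary using (¬_; yes; no)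

sumℤ-++ : ∀ xs ys → sumℤ (xs ++ ys) ≡ sumℤ xs + sumℤ ys
sumℤ-++ []       ys = sym (+-identityˡ _)
sumℤ-++ (x ∷ xs) ys = trans (cong (x +_) (sumℤ-++ xs ys)) (sym (+-assoc x _ _))

module _ {A : Set} where

  sumℤ-map-+ : ∀ (f g : A → ℤ) xs →
               sumℤ (map (λ x → f x + g x) xs) ≡ sumℤ (map f xs) + sumℤ (map g xs)
  sumℤ-map-+ f g []       = refl
  sumℤ-map-+ f g (x ∷ xs) = trans (cong (f x + g x +_) (sumℤ-map-+ f g xs))
    (middle-swap (f x) (g x) (sumℤ (map f xs)) (sumℤ (map g xs)))
    where
    middle-swap : ∀ a b c d → a + b + (c + d) ≡ a + c + (b + d)
    middle-swap = solve-∀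

  sumℤ-map-neg : ∀ (f : A → ℤ) xs → sumℤ (map (λ x → - f x) xs) ≡ - sumℤ (map f xs)
  sumℤ-map-neg f []       = refl
  sumℤ-map-neg f (x ∷ xs) =
    trans (cong (- f x +_) (sumℤ-map-neg f xs)) (sym (neg-distrib-+ (f x) _))

  sumℤ-map-*ˡ : ∀ c (f : A → ℤ) xs → sumℤ (map (λ x → c * f x) xs) ≡ c * sumℤ (map f xs)
  sumℤ-map-*ˡ c f []       = sym (*-zeroʳ c)
  sumℤ-map-*ˡ c f (x ∷ xs) =
    trans (cong (c * f x +_) (sumℤ-map-*ˡ c f xs)) (sym (*-distribˡ-+ c (f x) _))

  sumℤ-map-0 : ∀ (f : A → ℤ) xs → (∀ x → f x ≡ 0ℤ) → sumℤ (map f xs) ≡ 0ℤ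
  sumℤ-map-0 f []       _  = refl
  sumℤ-map-0 f (x ∷ xs) f0 = cong₂ _+_ (f0 x) (sumℤ-map-0 f xs f0)

-- Power series

≈-setoid : Setoid _ _
≈-setoid = record
  { Carrier       = FPS
  ; _≈_           = _≈_
  ; isEquivalence = record
    { refl  = λ _ → refl
    ; sym   = λ f≈g n → sym (f≈g n)
    ; trans = λ f≈g g≈h n → trans (f≈g n) (g≈h n)
    }
  }

open Setoid ≈-setoid using () renaming (refl to ≈-refl; sym to ≈-sym; trans to ≈-trans)
module ≈-Reasoning = SetoidReasoning ≈-setoid

infixr 7 _·_

_·_ : ℤ → FPS → FPS
(c · f) n = c * f n

tail : FPS → FPS
tail f n = f (suc n)

shift₁ : FPS → FPS
shift₁ f zero    = 0ℤ
shift₁ f (suc n) = f n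

shift : ℕ → FPS → FPS
shift zero    f = f
shift (suc j) f = shift₁ (shift j f)

shift-+ : ∀ i j f → shift i (shift j f) ≡ shift (i ℕ.+ j) f
shift-+ zero    j f = refl
shift-+ (suc i) j f = cong shift₁ (shift-+ i j f)

shift-≥ : ∀ j f {k} → j ≤ k → shift j f k ≡ f (k ∸ j)
shift-≥ zero    f z≤n       = refl
shift-≥ (suc j) f (s≤s j≤k) = shift-≥ j f j≤k

shift-< : ∀ j f {k} → k < j → shift j f k ≡ 0ℤ
shift-< (suc j) f {zero}  _         = refl
shift-< (suc j) f {suc k} (s≤s k<j) = shift-< j f k<j

⊕-cong : ∀ {f f′ g g′} → f ≈ f′ → g ≈ g′ → (f ⊕ g) ≈ (f′ ⊕ g′)
⊕-cong f≈f′ g≈g′ n = cong₂ _+_ (f≈f′ n) (g≈g′ n)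

⊕-congˡ : ∀ f {g g′} → g ≈ g′ → (f ⊕ g) ≈ (f ⊕ g′)
⊕-congˡ f = ⊕-cong {f} (λ _ → refl)

⊕-congʳ : ∀ g {f f′} → f ≈ f′ → (f ⊕ g) ≈ (f′ ⊕ g)
⊕-congʳ g f≈f′ = ⊕-cong {g = g} f≈f′ (λ _ → refl)

⊖-cong : ∀ {f f′} → f ≈ f′ → (⊖ f) ≈ (⊖ f′)
⊖-cong f≈f′ n = cong -_ (f≈f′ n)

·-cong : ∀ c {f f′} → f ≈ f′ → (c · f) ≈ (c · f′)
·-cong c f≈f′ n = cong (c *_) (f≈f′ n)

shift-cong : ∀ j {f f′} → f ≈ f′ → shift j f ≈ shift j f′
shift-cong zero    f≈f′ n       = f≈f′ n
shift-cong (suc j) f≈f′ zero    = refl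
shift-cong (suc j) f≈f′ (suc n) = shift-cong j f≈f′ n

shift-𝟘 : ∀ j → shift j 𝟘 ≈ 𝟘
shift-𝟘 zero    n       = refl
shift-𝟘 (suc j) zero    = refl
shift-𝟘 (suc j) (suc n) = shift-𝟘 j n

⊕-identityˡ : ∀ f → (𝟘 ⊕ f) ≈ f
⊕-identityˡ f n = +-identityˡ (f n)

⊕-identityʳ : ∀ f → (f ⊕ 𝟘) ≈ f
⊕-identityʳ f n = +-identityʳ (f n)

⊖-involutive : ∀ f → (⊖ (⊖ f)) ≈ f
⊖-involutive f n = neg-involutive (f n)

⊕-inverseʳ : ∀ f → (f ⊕ (⊖ f)) ≈ 𝟘
⊕-inverseʳ f n = +-inverseʳ (f n)

⊕-cancelʳ : ∀ f g → ((f ⊕ g) ⊕ (⊖ g)) ≈ f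
⊕-cancelʳ f g n = cancel (f n) (g n)
  where
  cancel : ∀ a b → a + b + - b ≡ a
  cancel = solve-∀

⊕-⊖-cancelˡ : ∀ f g → (f ⊕ (⊖ (f ⊕ g))) ≈ (⊖ g)
⊕-⊖-cancelˡ f g n = cancel (f n) (g n)
  where
  cancel : ∀ a b → a + - (a + b) ≡ - b
  cancel = solve-∀

-1^-even : ∀ m → -1ℤ ^ (m ℕ.* 2) ≡ 1ℤ
-1^-even zero    = refl
-1^-even (suc m) = begin
  -1ℤ * (-1ℤ * -1ℤ ^ (m ℕ.* 2)) ≡⟨ cong (λ x → -1ℤ * (-1ℤ * x)) (-1^-even m) ⟩
  1ℤ                             ∎
  where open ≡-Reasoning

·-even : ∀ m f → (-1ℤ ^ (m ℕ.* 2) · f) ≈ f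
·-even m f n = trans (cong (_* f n) (-1^-even m)) (*-identityˡ (f n))

·-odd : ∀ m f → (-1ℤ ^ suc (m ℕ.* 2) · f) ≈ (⊖ f)
·-odd m f n = trans (cong (λ x → -1ℤ * x * f n) (-1^-even m)) (-1*i≡-i (f n))

⊗-zero : ∀ f g → (f ⊗ g) 0 ≡ f 0 * g 0
⊗-zero f g = +-identityʳ _

⊗-sucˡ : ∀ f g n → (f ⊗ g) (suc n) ≡ f 0 * g (suc n) + (tail f ⊗ g) n
⊗-sucˡ f g n = cong (λ xs → f 0 * g (suc n) + sumℤ xs)
  (trans (map-applyUpTo suc term (suc n)) (sym (map-upTo (λ i → term (suc i)) (suc n))))
  where
  term : ℕ → ℤ
  term i = f i * g (suc n ∸ i)

⊗-sucʳ : ∀ f g n → (f ⊗ g) (suc n) ≡ (f ⊗ tail g) n + f (suc n) * g 0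
⊗-sucʳ f g n = begin
  sumℤ (map term (upTo (suc (suc n))))
    ≡⟨ cong (λ xs → sumℤ (map term xs)) (sym (upTo-∷ʳ (suc n))) ⟩
  sumℤ (map term (upTo (suc n) ++ [ suc n ]))
    ≡⟨ cong sumℤ (map-++ term (upTo (suc n)) [ suc n ]) ⟩
  sumℤ (map term (upTo (suc n)) ++ [ term (suc n) ])
    ≡⟨ sumℤ-++ (map term (upTo (suc n))) [ term (suc n) ] ⟩
  sumℤ (map term (upTo (suc n))) + (term (suc n) + 0ℤ)
    ≡⟨ cong₂ _+_ (cong sumℤ (map-cong-local (applyUpTo⁺₁ (λ i → i) (suc n) shifted)))
                 (trans (+-identityʳ _) (cong (λ m → f (suc n) * g m) (ℕ.n∸n≡0 n))) ⟩
  (f ⊗ tail g) n + f (suc n) * g 0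
    ∎
  where
  open ≡-Reasoning
  term : ℕ → ℤ
  term i = f i * g (suc n ∸ i)
  shifted : ∀ {i} → i < suc n → term i ≡ f i * tail g (n ∸ i)
  shifted {i} i<sn = cong (λ m → f i * g m) (ℕ.+-∸-assoc 1 (ℕ.≤-pred i<sn))

⊗-cong : ∀ {f f′ g g′} → f ≈ f′ → g ≈ g′ → (f ⊗ g) ≈ (f′ ⊗ g′)
⊗-cong f≈f′ g≈g′ n = cong sumℤ (map-cong (λ i → cong₂ _*_ (f≈f′ i) (g≈g′ (n ∸ i))) (upTo (suc n)))

⊗-congˡ : ∀ f {g g′} → g ≈ g′ → (f ⊗ g) ≈ (f ⊗ g′)
⊗-congˡ f = ⊗-cong {f} (λ _ → refl)

⊗-congʳ : ∀ g {f f′} → f ≈ f′ → (f ⊗ g) ≈ (f′ ⊗ g)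
⊗-congʳ g f≈f′ = ⊗-cong {g = g} f≈f′ (λ _ → refl)

⊗-distribˡ : ∀ f g h → (f ⊗ (g ⊕ h)) ≈ ((f ⊗ g) ⊕ (f ⊗ h))
⊗-distribˡ f g h n = trans
  (cong sumℤ (map-cong (λ i → *-distribˡ-+ (f i) (g (n ∸ i)) (h (n ∸ i))) (upTo (suc n))))
  (sumℤ-map-+ (λ i → f i * g (n ∸ i)) (λ i → f i * h (n ∸ i)) (upTo (suc n)))

⊗-distribʳ : ∀ f g h → ((g ⊕ h) ⊗ f) ≈ ((g ⊗ f) ⊕ (h ⊗ f))
⊗-distribʳ f g h n = trans
  (cong sumℤ (map-cong (λ i → *-distribʳ-+ (f (n ∸ i)) (g i) (h i)) (upTo (suc n))))
  (sumℤ-map-+ (λ i → g i * f (n ∸ i)) (λ i → h i * f (n ∸ i)) (upTo (suc n)))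

⊗-negˡ : ∀ f g → ((⊖ f) ⊗ g) ≈ (⊖ (f ⊗ g))
⊗-negˡ f g n = trans
  (cong sumℤ (map-cong (λ i → sym (neg-distribˡ-* (f i) (g (n ∸ i)))) (upTo (suc n))))
  (sumℤ-map-neg (λ i → f i * g (n ∸ i)) (upTo (suc n)))

⊗-negʳ : ∀ f g → (f ⊗ (⊖ g)) ≈ (⊖ (f ⊗ g))
⊗-negʳ f g n = trans
  (cong sumℤ (map-cong (λ i → sym (neg-distribʳ-* (f i) (g (n ∸ i)))) (upTo (suc n))))
  (sumℤ-map-neg (λ i → f i * g (n ∸ i)) (upTo (suc n)))

⊗-shift₁ˡ : ∀ f g → (shift₁ f ⊗ g) ≈ shift₁ (f ⊗ g)
⊗-shift₁ˡ f g zero    = trans (⊗-zero (shift₁ f) g) (*-zeroˡ (g 0))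
⊗-shift₁ˡ f g (suc n) =
  trans (⊗-sucˡ (shift₁ f) g n) (trans (cong (_+ (f ⊗ g) n) (*-zeroˡ (g (suc n)))) (+-identityˡ _))

⊗-shift₁ʳ : ∀ f g → (f ⊗ shift₁ g) ≈ shift₁ (f ⊗ g)
⊗-shift₁ʳ f g zero    = trans (⊗-zero f (shift₁ g)) (*-zeroʳ (f 0))
⊗-shift₁ʳ f g (suc n) =
  trans (⊗-sucʳ f (shift₁ g) n) (trans (cong ((f ⊗ g) n +_) (*-zeroʳ (f (suc n)))) (+-identityʳ _))

⊗-shiftˡ : ∀ j f g → (shift j f ⊗ g) ≈ shift j (f ⊗ g)
⊗-shiftˡ zero    f g = ≈-refl
⊗-shiftˡ (suc j) f g = ≈-trans (⊗-shift₁ˡ (shift j f) g) (shift-cong 1 (⊗-shiftˡ j f g))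

⊗-shiftʳ : ∀ j f g → (f ⊗ shift j g) ≈ shift j (f ⊗ g)
⊗-shiftʳ zero    f g = ≈-refl
⊗-shiftʳ (suc j) f g = ≈-trans (⊗-shift₁ʳ f (shift j g)) (shift-cong 1 (⊗-shiftʳ j f g))

⊗-identityˡ : ∀ g → (𝟙 ⊗ g) ≈ g
⊗-identityˡ g zero    = trans (⊗-zero 𝟙 g) (*-identityˡ (g 0))
⊗-identityˡ g (suc n) = trans (⊗-sucˡ 𝟙 g n) (trans (cong₂ _+_ (*-identityˡ (g (suc n)))
  (sumℤ-map-0 _ (upTo (suc n)) (λ i → *-zeroˡ (g (n ∸ i))))) (+-identityʳ _))

⊗-identityʳ : ∀ g → (g ⊗ 𝟙) ≈ g
⊗-identityʳ g zero    = trans (⊗-zero g 𝟙) (*-identityʳ (g 0))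
⊗-identityʳ g (suc n) = trans (⊗-sucʳ g 𝟙 n) (trans (cong₂ _+_
  (sumℤ-map-0 _ (upTo (suc n)) (λ i → *-zeroʳ (g i))) (*-identityʳ (g (suc n)))) (+-identityˡ _))

monomial-⊗ : ∀ i j → (shift i 𝟙 ⊗ shift j 𝟙) ≈ shift (i ℕ.+ j) 𝟙
monomial-⊗ i j = begin
  shift i 𝟙 ⊗ shift j 𝟙    ≈⟨ ⊗-shiftˡ i 𝟙 (shift j 𝟙) ⟩
  shift i (𝟙 ⊗ shift j 𝟙)  ≈⟨ shift-cong i (⊗-identityˡ (shift j 𝟙)) ⟩
  shift i (shift j 𝟙)      ≡⟨ shift-+ i j 𝟙 ⟩
  shift (i ℕ.+ j) 𝟙        ∎
  where open ≈-Reasoning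

^^-monomial : ∀ {f} j → f ≈ shift j 𝟙 → ∀ m → (f ^^ m) ≈ shift (m ℕ.* j) 𝟙
^^-monomial j f≈qʲ zero    = ≈-refl
^^-monomial j f≈qʲ (suc m) =
  ≈-trans (⊗-cong f≈qʲ (^^-monomial j f≈qʲ m)) (monomial-⊗ j (m ℕ.* j))

q≈shift₁𝟙 : q ≈ shift 1 𝟙
q≈shift₁𝟙 zero          = refl
q≈shift₁𝟙 (suc zero)    = refl
q≈shift₁𝟙 (suc (suc n)) = refl

q²-power : ∀ m → ((q ^^ 2) ^^ m) ≈ shift (m ℕ.* 2) 𝟙
q²-power = ^^-monomial 2 (^^-monomial 1 q≈shift₁𝟙 2)

⊗-fold : (ℕ → FPS) → List ℕ → FPS → FPS
⊗-fold F xs s = foldr (λ i acc → F i ⊗ acc) s xs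

⊗-fold-cong : ∀ F xs {s s′} → s ≈ s′ → ⊗-fold F xs s ≈ ⊗-fold F xs s′
⊗-fold-cong F []       s≈s′ = s≈s′
⊗-fold-cong F (x ∷ xs) s≈s′ = ⊗-congˡ (F x) (⊗-fold-cong F xs s≈s′)

⊗-fold-⊕ : ∀ F xs s t → ⊗-fold F xs (s ⊕ t) ≈ (⊗-fold F xs s ⊕ ⊗-fold F xs t)
⊗-fold-⊕ F []       s t = ≈-refl
⊗-fold-⊕ F (x ∷ xs) s t =
  ≈-trans (⊗-congˡ (F x) (⊗-fold-⊕ F xs s t)) (⊗-distribˡ (F x) _ _)

⊗-fold-⊖ : ∀ F xs s → ⊗-fold F xs (⊖ s) ≈ (⊖ ⊗-fold F xs s)
⊗-fold-⊖ F []       s = ≈-refl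
⊗-fold-⊖ F (x ∷ xs) s = ≈-trans (⊗-congˡ (F x) (⊗-fold-⊖ F xs s)) (⊗-negʳ (F x) _)

⊗-fold-shift : ∀ F xs j s → ⊗-fold F xs (shift j s) ≈ shift j (⊗-fold F xs s)
⊗-fold-shift F []       j s = ≈-refl
⊗-fold-shift F (x ∷ xs) j s =
  ≈-trans (⊗-congˡ (F x) (⊗-fold-shift F xs j s)) (⊗-shiftʳ j (F x) _)

pochFactor : FPS → FPS → ℕ → FPS
pochFactor a b i = 𝟙 ⊕ (⊖ (a ⊗ (b ^^ i)))

-- Keeping the last factor as the seed of the fold avoids associativity of ⊗.
poch-suc : ∀ a b l →
  poch a b (suc l) ≈ (poch a b l ⊕ (⊖ ⊗-fold (pochFactor a b) (upTo l) (a ⊗ (b ^^ l))))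
poch-suc a b l = begin
  ⊗-fold F (upTo (suc l)) 𝟙          ≡⟨ cong (λ xs → ⊗-fold F xs 𝟙) (sym (upTo-∷ʳ l)) ⟩
  ⊗-fold F (upTo l ∷ʳ l) 𝟙           ≡⟨ foldr-∷ʳ _ 𝟙 l (upTo l) ⟩
  ⊗-fold F (upTo l) (F l ⊗ 𝟙)         ≈⟨ ⊗-fold-cong F (upTo l) (⊗-identityʳ (F l)) ⟩
  ⊗-fold F (upTo l) (𝟙 ⊕ (⊖ abˡ))    ≈⟨ ⊗-fold-⊕ F (upTo l) 𝟙 (⊖ abˡ) ⟩
  (poch a b l ⊕ ⊗-fold F (upTo l) (⊖ abˡ))
                                      ≈⟨ ⊕-congˡ (poch a b l) (⊗-fold-⊖ F (upTo l) abˡ) ⟩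
  (poch a b l ⊕ (⊖ ⊗-fold F (upTo l) abˡ)) ∎
  where
  open ≈-Reasoning
  F : ℕ → FPS
  F = pochFactor a b
  abˡ : FPS
  abˡ = a ⊗ (b ^^ l)

poch-−q-q²-suc : ∀ m → poch (⊖ q) (q ^^ 2) (suc m)
                       ≈ (poch (⊖ q) (q ^^ 2) m ⊕ shift (suc (m ℕ.* 2)) (poch (⊖ q) (q ^^ 2) m))
poch-−q-q²-suc m = begin
  poch (⊖ q) (q ^^ 2) (suc m)            ≈⟨ poch-suc (⊖ q) (q ^^ 2) m ⟩
  (P ⊕ (⊖ ⊗-fold F xs ((⊖ q) ⊗ q²ᵐ)))    ≈⟨ ⊕-congˡ P (⊖-cong (⊗-fold-cong F xs factor≈)) ⟩
  (P ⊕ (⊖ ⊗-fold F xs (⊖ qʲ)))           ≈⟨ ⊕-congˡ P (⊖-cong (⊗-fold-⊖ F xs qʲ)) ⟩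
  (P ⊕ (⊖ (⊖ ⊗-fold F xs qʲ)))           ≈⟨ ⊕-congˡ P (⊖-involutive (⊗-fold F xs qʲ)) ⟩
  (P ⊕ ⊗-fold F xs qʲ)                   ≈⟨ ⊕-congˡ P (⊗-fold-shift F xs j 𝟙) ⟩
  (P ⊕ shift j P)                        ∎
  where
  open ≈-Reasoning
  j : ℕ
  j = suc (m ℕ.* 2)
  P q²ᵐ qʲ : FPS
  P = poch (⊖ q) (q ^^ 2) m
  q²ᵐ = (q ^^ 2) ^^ m
  qʲ = shift j 𝟙
  F : ℕ → FPS
  F = pochFactor (⊖ q) (q ^^ 2)
  xs : List ℕ
  xs = upTo m
  factor≈ : ((⊖ q) ⊗ q²ᵐ) ≈ (⊖ qʲ)
  factor≈ = ≈-trans (⊗-negˡ q q²ᵐ)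
    (⊖-cong (≈-trans (⊗-cong q≈shift₁𝟙 (q²-power m)) (monomial-⊗ 1 (m ℕ.* 2))))

poch-q²-q²-suc : ∀ m → poch (q ^^ 2) (q ^^ 2) (suc m)
                       ≈ (poch (q ^^ 2) (q ^^ 2) m ⊕ (⊖ shift (suc (suc (m ℕ.* 2))) (poch (q ^^ 2) (q ^^ 2) m)))
poch-q²-q²-suc m = begin
  poch (q ^^ 2) (q ^^ 2) (suc m)         ≈⟨ poch-suc (q ^^ 2) (q ^^ 2) m ⟩
  (P ⊕ (⊖ ⊗-fold F xs ((q ^^ 2) ⊗ q²ᵐ)))  ≈⟨ ⊕-congˡ P (⊖-cong (⊗-fold-cong F xs factor≈)) ⟩
  (P ⊕ (⊖ ⊗-fold F xs qʲ))               ≈⟨ ⊕-congˡ P (⊖-cong (⊗-fold-shift F xs j 𝟙)) ⟩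
  (P ⊕ (⊖ shift j P))                    ∎
  where
  open ≈-Reasoning
  j : ℕ
  j = suc (suc (m ℕ.* 2))
  P q²ᵐ qʲ : FPS
  P = poch (q ^^ 2) (q ^^ 2) m
  q²ᵐ = (q ^^ 2) ^^ m
  qʲ = shift j 𝟙
  F : ℕ → FPS
  F = pochFactor (q ^^ 2) (q ^^ 2)
  xs : List ℕ
  xs = upTo m
  factor≈ : ((q ^^ 2) ⊗ q²ᵐ) ≈ qʲ
  factor≈ = ≈-trans (⊗-cong (^^-monomial 1 q≈shift₁𝟙 2) (q²-power m)) (monomial-⊗ 2 (m ℕ.* 2))

-- Fixed points of causal operators

Causal : (FPS → FPS) → Set
Causal Φ = ∀ f g k → (∀ i → i < k → f i ≡ g i) → Φ f k ≡ Φ g k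

-- The k-th coefficient of Φⁿ(𝟘) no longer changes once n > k.
fix : (FPS → FPS) → FPS
fix Φ k = fold 𝟘 Φ (suc k) k

module _ {Φ : FPS → FPS} (causal : Causal Φ) where

  fold-stable : ∀ m n k → k < m → k < n → fold 𝟘 Φ m k ≡ fold 𝟘 Φ n k
  fold-stable (suc m) (suc n) k (s≤s k≤m) (s≤s k≤n) = causal _ _ k λ i i<k →
    fold-stable m n i (ℕ.<-≤-trans i<k k≤m) (ℕ.<-≤-trans i<k k≤n)

  fix-unfold : fix Φ ≈ Φ (fix Φ)
  fix-unfold k = causal _ _ k λ i i<k → fold-stable k (suc i) i i<k (ℕ.n<1+n i)

  fixpoint-unique : ∀ {f g} → f ≈ Φ f → g ≈ Φ g → f ≈ g
  fixpoint-unique {f} {g} f≈Φf g≈Φg = <-rec (λ k → f k ≡ g k) λ k rec →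
    trans (f≈Φf k) (trans (causal f g k (λ i i<k → rec i<k)) (sym (g≈Φg k)))

shift-causal : ∀ j → Causal (shift (suc j))
shift-causal j f g k f≡g with suc j ℕ.≤? k
... | yes j<k = trans (shift-≥ (suc j) f j<k)
                (trans (f≡g (k ∸ suc j) (ℕ.∸-monoʳ-< z<s j<k)) (sym (shift-≥ (suc j) g j<k)))
... | no  j≮k = trans (shift-< (suc j) f (ℕ.≰⇒> j≮k)) (sym (shift-< (suc j) g (ℕ.≰⇒> j≮k)))

-- Weighted counts of finite sets

open Equivalence using (to; from)

module _ {A : Set} where

  WeightedSum : (A → ℤ) → (A → Set) → ℤ → Set
  WeightedSum w S c =
    Σ (List A) λ L → Unique L × (∀ x → (x ∈ L) ⇔ S x) × (sumℤ (map w L) ≡ c)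

  WeightedSum-resp : ∀ {w S T c} → (∀ x → S x ⇔ T x) → WeightedSum w S c → WeightedSum w T c
  WeightedSum-resp S⇔T (L , unique , L⇔S , sum) = L , unique , (λ x → S⇔T x ⇔-∘ L⇔S x) , sum

  WeightedSum-∅ : ∀ {w S} → (∀ x → ¬ S x) → WeightedSum w S 0ℤ
  WeightedSum-∅ ¬S = [] , [] , (λ x → mk⇔ (λ ()) (λ s → ⊥-elim (¬S x s))) , refl

  WeightedSum-singleton : ∀ w a → WeightedSum w (_≡ a) (w a)
  WeightedSum-singleton w a =
    [ a ] , [] ∷ [] , (λ x → mk⇔ (λ { (here x≡a) → x≡a ; (there ()) }) here) , +-identityʳ (w a)

  WeightedSum-⊎ : ∀ {w S T a b} → (∀ x → S x → T x → ⊥) →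
                  WeightedSum w S a → WeightedSum w T b → WeightedSum w (λ x → S x ⊎ T x) (a + b)
  WeightedSum-⊎ {w} {S} {T} disjoint (L , uL , L⇔S , sumL) (M , uM , M⇔T , sumM) =
    L ++ M ,
    Unique.++⁺ uL uM (λ (x∈L , x∈M) → disjoint _ (to (L⇔S _) x∈L) (to (M⇔T _) x∈M)) ,
    (λ x → mk⇔ (into x) (outof x)) ,
    trans (cong sumℤ (map-++ w L M)) (trans (sumℤ-++ (map w L) (map w M)) (cong₂ _+_ sumL sumM))
    where
    into : ∀ x → x ∈ L ++ M → S x ⊎ T x
    into x x∈L++M with ∈-++⁻ L x∈L++M
    ... | inj₁ x∈L = inj₁ (to (L⇔S x) x∈L)
    ... | inj₂ x∈M = inj₂ (to (M⇔T x) x∈M)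
    outof : ∀ x → S x ⊎ T x → x ∈ L ++ M
    outof x (inj₁ s) = ∈-++⁺ˡ (from (L⇔S x) s)
    outof x (inj₂ t) = ∈-++⁺ʳ L (from (M⇔T x) t)

Image : {A B : Set} → (A → B) → (A → Set) → B → Set
Image {A} f S y = Σ A λ x → y ≡ f x × S x

WeightedSum-image : ∀ {A B : Set} {v : A → ℤ} {w : B → ℤ} {S a} (f : A → B) c →
  (∀ {x y} → f x ≡ f y → x ≡ y) → (∀ x → w (f x) ≡ c * v x) →
  WeightedSum v S a → WeightedSum w (Image f S) (c * a)
WeightedSum-image {v = v} {w} {S} f c injective w∘f≡c*v (L , uL , L⇔S , sumL) =
  map f L ,
  Unique.map⁺ injective uL ,
  (λ y → mk⇔ (into y) (outof y)) ,
  (begin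
    sumℤ (map w (map f L))          ≡⟨ cong sumℤ (sym (map-∘ L)) ⟩
    sumℤ (map (λ x → w (f x)) L)    ≡⟨ cong sumℤ (map-cong w∘f≡c*v L) ⟩
    sumℤ (map (λ x → c * v x) L)    ≡⟨ sumℤ-map-*ˡ c v L ⟩
    c * sumℤ (map v L)              ≡⟨ cong (c *_) sumL ⟩
    c * _                           ∎)
  where
  open ≡-Reasoning
  into : ∀ y → y ∈ map f L → Image f S y
  into y y∈fL with ∈-map⁻ f y∈fL
  ... | x , x∈L , y≡fx = x , y≡fx , to (L⇔S x) x∈L
  outof : ∀ y → Image f S y → y ∈ map f L
  outof _ (x , refl , s) = ∈-map⁺ f (from (L⇔S x) s)

Coeff : (List ℕ → ℤ) → (List ℕ → ℕ) → (List ℕ → Set) → ℕ → ℤ → Set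
Coeff w deg S k c = WeightedSum w (λ π → S π × deg π ≡ k) c

HasGF : (List ℕ → ℤ) → (List ℕ → ℕ) → (List ℕ → Set) → FPS → Set
HasGF w deg S f = ∀ k → Coeff w deg S k (f k)

HasGF-resp : ∀ {w deg S f g} → f ≈ g → HasGF w deg S f → HasGF w deg S g
HasGF-resp {w} {deg} {S} f≈g gf k = subst (Coeff w deg S k) (f≈g k) (gf k)

HasGF-only-[] : ∀ {w deg S} → (∀ π → S π ⇔ (π ≡ [])) → w [] ≡ 1ℤ → deg [] ≡ 0 →
                HasGF w deg S 𝟙
HasGF-only-[] {w} {deg} {S} S⇔[] w[]≡1 deg[]≡0 zero =
  subst (Coeff w deg S 0) w[]≡1 (WeightedSum-resp only-[] (WeightedSum-singleton w []))
  where
  only-[] : ∀ π → π ≡ [] ⇔ (S π × deg π ≡ 0)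
  only-[] π = mk⇔ (λ { refl → from (S⇔[] []) refl , deg[]≡0 }) (λ (s , _) → to (S⇔[] π) s)
HasGF-only-[] {w} {deg} {S} S⇔[] w[]≡1 deg[]≡0 (suc k) = WeightedSum-∅ nothing
  where
  nothing : ∀ π → ¬ (S π × deg π ≡ suc k)
  nothing π (s , deg≡1+k) with to (S⇔[] π) s
  ... | refl = ℕ.0≢1+n (trans (sym deg[]≡0) deg≡1+k)

Coeff-split : ∀ {w deg S A B k a b} →
  (∀ π → S π ⇔ (A π ⊎ B π)) → (∀ π → A π → B π → ⊥) →
  Coeff w deg A k a → Coeff w deg B k b → Coeff w deg S k (a + b)
Coeff-split {deg = deg} {S} {A} {B} {k} S⇔A⊎B disjoint cA cB =
  WeightedSum-resp regroup (WeightedSum-⊎ (λ π (a , _) (b , _) → disjoint π a b) cA cB)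
  where
  regroup : ∀ π → ((A π × deg π ≡ k) ⊎ (B π × deg π ≡ k)) ⇔ (S π × deg π ≡ k)
  regroup π = mk⇔
    (λ { (inj₁ (a , d)) → from (S⇔A⊎B π) (inj₁ a) , d ; (inj₂ (b , d)) → from (S⇔A⊎B π) (inj₂ b) , d })
    (λ (s , d) → Sum.map (_, d) (_, d) (to (S⇔A⊎B π) s))

sign′ : List ℕ → ℤ
sign′ π = -1ℤ ^ ℰ π

Cons : ℕ → (List ℕ → Set) → List ℕ → Set
Cons x = Image (x ∷_)

Coeff-Cons-ℰ : ∀ x {T k c} → Coeff sign′ 𝒪 T k c → Coeff sign ℰ (Cons x T) k (-1ℤ ^ x * c)
Coeff-Cons-ℰ x {T} {k} c =
  WeightedSum-resp regroup
    (WeightedSum-image (x ∷_) (-1ℤ ^ x) ∷-injectiveʳ (λ π → ^-distribˡ-+-* -1ℤ x (ℰ π)) c)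
  where
  regroup : ∀ π → Image (x ∷_) (λ π′ → T π′ × 𝒪 π′ ≡ k) π ⇔ (Cons x T π × ℰ π ≡ k)
  regroup π = mk⇔ (λ { (π′ , refl , t , d) → (π′ , refl , t) , d })
                  (λ { ((π′ , refl , t) , d) → π′ , refl , t , d })

Coeff-Cons-𝒪 : ∀ x {T k} f → (x ≤ k → Coeff sign ℰ T (k ∸ x) (f (k ∸ x))) →
               Coeff sign′ 𝒪 (Cons x T) k (shift x f k)
Coeff-Cons-𝒪 x {T} {k} f c with x ℕ.≤? k
... | yes x≤k = subst (Coeff sign′ 𝒪 (Cons x T) k) (sym (shift-≥ x f x≤k))
  (subst (Coeff sign′ 𝒪 (Cons x T) k) (*-identityˡ _)
    (WeightedSum-resp regroup
      (WeightedSum-image (x ∷_) 1ℤ ∷-injectiveʳ (λ π → sym (*-identityˡ (sign π))) (c x≤k))))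
  where
  regroup : ∀ π → Image (x ∷_) (λ π′ → T π′ × ℰ π′ ≡ k ∸ x) π ⇔ (Cons x T π × 𝒪 π ≡ k)
  regroup π = mk⇔
    (λ { (π′ , refl , t , d) → (π′ , refl , t) , trans (cong (x ℕ.+_) d) (ℕ.m+[n∸m]≡n x≤k) })
    (λ { ((π′ , refl , t) , d) → π′ , refl , t , trans (sym (ℕ.m+n∸m≡n x (ℰ π′))) (cong (_∸ x) d) })
... | no x≰k = subst (Coeff sign′ 𝒪 (Cons x T) k) (sym (shift-< x f (ℕ.≰⇒> x≰k)))
  (WeightedSum-∅ λ { π ((π′ , refl , _) , d) → x≰k (subst (x ≤_) d (ℕ.m≤m+n x (ℰ π′))) })

-- Partitions with bounded parts

module _ {A : Set} {R : A → A → Set} where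

  Linked-∷⁺ : ∀ {x xs} → All (R x) xs → Linked R xs → Linked R (x ∷ xs)
  Linked-∷⁺ []        []  = [-]
  Linked-∷⁺ (Rxy ∷ _) Rxs = Rxy ∷ Rxs

  Linked-∷⁻ : (∀ {x y z} → R x y → R y z → R x z) → ∀ {x xs} → Linked R (x ∷ xs) → All (R x) xs
  Linked-∷⁻ trans [-]         = []
  Linked-∷⁻ trans (Rxy ∷ Rxs) = Linked⇒All trans Rxy Rxs

InP-zero : ∀ π → InP 0 π ⇔ (π ≡ [])
InP-zero π = mk⇔ (empty π) (λ { refl → ([] , []) , [] })
  where
  empty : ∀ π → InP 0 π → π ≡ []
  empty []      _                         = refl
  empty (x ∷ _) ((_ , 0<x ∷ _) , x≤0 ∷ _) = ⊥-elim (ℕ.<⇒≱ 0<x x≤0)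

InD-zero : ∀ π → InD 0 π ⇔ (π ≡ [])
InD-zero π = mk⇔ (λ (p , _) → to (InP-zero π) p) (λ { refl → (([] , []) , []) , [] })

InP-suc-weaken : ∀ {M π} → InP M π → InP (suc M) π
InP-suc-weaken (partition , bounded) = partition , All.map ℕ.m≤n⇒m≤1+n bounded

InP-suc : ∀ M π → InP (suc M) π ⇔ (InP M π ⊎ Cons (suc M) (InP (suc M)) π)
InP-suc M π = mk⇔ (split π) join
  where
  split : ∀ π → InP (suc M) π → InP M π ⊎ Cons (suc M) (InP (suc M)) π
  split []       _ = inj₁ (([] , []) , [])
  split (x ∷ xs) ((ordered , positive) , x≤1+M ∷ bounded) with ℕ.m≤n⇒m<n∨m≡n x≤1+M
  ... | inj₁ x<1+M = inj₁ ((ordered , positive) , Linked⇒All ≥-trans (ℕ.≤-pred x<1+M) ordered)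
  ... | inj₂ refl  = inj₂ (xs , refl , (Linked.tail ordered , All.tail positive) , bounded)
  join : ∀ {π} → InP M π ⊎ Cons (suc M) (InP (suc M)) π → InP (suc M) π
  join (inj₁ p) = InP-suc-weaken p
  join (inj₂ (xs , refl , (ordered , positive) , bounded)) =
    (Linked-∷⁺ bounded ordered , z<s ∷ positive) , ℕ.≤-refl ∷ bounded

InD-suc : ∀ M π → InD (suc M) π ⇔ (InD M π ⊎ Cons (suc M) (InD M) π)
InD-suc M π = mk⇔ (split π) join
  where
  split : ∀ π → InD (suc M) π → InD M π ⊎ Cons (suc M) (InD M) π
  split π (p , distinct) with to (InP-suc M π) p
  ... | inj₁ p′ = inj₁ (p′ , distinct)
  ... | inj₂ (xs , refl , partition , _) =
    inj₂ (xs , refl , (partition , All.map ℕ.≤-pred (Linked-∷⁻ >-trans distinct)) , Linked.tail distinct)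
  join : ∀ {π} → InD M π ⊎ Cons (suc M) (InD M) π → InD (suc M) π
  join (inj₁ (p , distinct)) = InP-suc-weaken p , distinct
  join (inj₂ (xs , refl , p , distinct)) =
    from (InP-suc M _) (inj₂ (xs , refl , InP-suc-weaken p)) ,
    Linked-∷⁺ (All.map s≤s (proj₂ p)) distinct

InP-Cons-disjoint : ∀ M {T} π → InP M π → Cons (suc M) T π → ⊥
InP-Cons-disjoint M _ (_ , 1+M≤M ∷ _) (_ , refl , _) = ℕ.n≮n M 1+M≤M

-- Generating functions of partitions

-- genD N, genD′ N (and genP N, genP′ N below) are F_N, G_N for distinct (unrestricted) parts.
mutual
  genD genD′ : ℕ → FPS
  genD zero     = 𝟙
  genD (suc M)  = genD M ⊕ (-1ℤ ^ suc M · genD′ M)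
  genD′ zero    = 𝟙
  genD′ (suc M) = genD′ M ⊕ shift (suc M) (genD M)

genD-correct : ∀ N → HasGF sign ℰ (InD N) (genD N) × HasGF sign′ 𝒪 (InD N) (genD′ N)
genD-correct zero    = HasGF-only-[] InD-zero refl refl , HasGF-only-[] InD-zero refl refl
genD-correct (suc M) =
  (λ k → Coeff-split (InD-suc M) disjoint (ℰ-gf k) (Coeff-Cons-ℰ (suc M) (𝒪-gf k))) ,
  (λ k → Coeff-split (InD-suc M) disjoint (𝒪-gf k)
           (Coeff-Cons-𝒪 (suc M) (genD M) (λ _ → ℰ-gf (k ∸ suc M))))
  where
  ℰ-gf : HasGF sign ℰ (InD M) (genD M)
  ℰ-gf = proj₁ (genD-correct M)
  𝒪-gf : HasGF sign′ 𝒪 (InD M) (genD′ M)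
  𝒪-gf = proj₂ (genD-correct M)
  disjoint : ∀ π → InD M π → Cons (suc M) (InD M) π → ⊥
  disjoint π (p , _) = InP-Cons-disjoint M π p

-- For unrestricted parts the head M+1 may repeat, so genP (M+1) is defined by a fixed-point equation.
mutual
  genP genP′ : ℕ → FPS
  genP zero     = 𝟙
  genP (suc M)  = fix (genP-step M)
  genP′ zero    = 𝟙
  genP′ (suc M) = genP′ M ⊕ shift (suc M) (genP (suc M))

  genP-step : ℕ → FPS → FPS
  genP-step M F = genP M ⊕ (-1ℤ ^ suc M · (genP′ M ⊕ shift (suc M) F))

genP-step-causal : ∀ M → Causal (genP-step M)
genP-step-causal M f g k f≡g =
  cong (λ x → genP M k + -1ℤ ^ suc M * (genP′ M k + x)) (shift-causal M f g k f≡g)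

genP-unfold : ∀ M → genP (suc M) ≈ genP-step M (genP (suc M))
genP-unfold M = fix-unfold (genP-step-causal M)

genP-correct : ∀ N → HasGF sign ℰ (InP N) (genP N) × HasGF sign′ 𝒪 (InP N) (genP′ N)
genP-correct zero    = HasGF-only-[] InP-zero refl refl , HasGF-only-[] InP-zero refl refl
genP-correct (suc M) = ℰ-gf′ , λ k → 𝒪-coeff k (λ _ → ℰ-gf′ (k ∸ suc M))
  where
  ℰ-gf : HasGF sign ℰ (InP M) (genP M)
  ℰ-gf = proj₁ (genP-correct M)
  𝒪-gf : HasGF sign′ 𝒪 (InP M) (genP′ M)
  𝒪-gf = proj₂ (genP-correct M)
  𝒪-coeff : ∀ k → (suc M ≤ k → Coeff sign ℰ (InP (suc M)) (k ∸ suc M) (genP (suc M) (k ∸ suc M))) →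
            Coeff sign′ 𝒪 (InP (suc M)) k (genP′ (suc M) k)
  𝒪-coeff k c =
    Coeff-split (InP-suc M) (InP-Cons-disjoint M) (𝒪-gf k) (Coeff-Cons-𝒪 (suc M) (genP (suc M)) c)
  -- The coefficient of qᵏ only needs coefficients of q^{k-M-1}, whence strong induction on k.
  ℰ-gf′ : HasGF sign ℰ (InP (suc M)) (genP (suc M))
  ℰ-gf′ = <-rec _ λ k rec →
    subst (Coeff sign ℰ (InP (suc M)) k) (sym (genP-unfold M k))
      (Coeff-split (InP-suc M) (InP-Cons-disjoint M) (ℰ-gf k)
        (Coeff-Cons-ℰ (suc M) (𝒪-coeff k (λ 1+M≤k → rec (ℕ.∸-monoʳ-< z<s 1+M≤k)))))

-- Evaluation by parity

mutual
  genD-even : ∀ m → (genD (m ℕ.* 2) ≈ poch (⊖ q) (q ^^ 2) m)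
                  × (genD′ (m ℕ.* 2) ≈ poch (⊖ q) (q ^^ 2) m)
  genD-even zero    = ≈-refl , ≈-refl
  genD-even (suc m) = ℰ-series , 𝒪-series
    where
    open ≈-Reasoning
    P : FPS
    P = poch (⊖ q) (q ^^ 2) (suc m)
    ℰ-series : genD (suc m ℕ.* 2) ≈ P
    ℰ-series = begin
      (genD (suc (m ℕ.* 2)) ⊕ (-1ℤ ^ (suc m ℕ.* 2) · genD′ (suc (m ℕ.* 2))))
        ≈⟨ ⊕-cong (proj₁ (genD-odd m)) (·-cong (-1ℤ ^ (suc m ℕ.* 2)) (proj₂ (genD-odd m))) ⟩
      (𝟘 ⊕ (-1ℤ ^ (suc m ℕ.* 2) · P))  ≈⟨ ⊕-identityˡ _ ⟩
      (-1ℤ ^ (suc m ℕ.* 2) · P)         ≈⟨ ·-even (suc m) P ⟩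
      P                                 ∎
    𝒪-series : genD′ (suc m ℕ.* 2) ≈ P
    𝒪-series = begin
      (genD′ (suc (m ℕ.* 2)) ⊕ shift (suc m ℕ.* 2) (genD (suc (m ℕ.* 2))))
        ≈⟨ ⊕-cong (proj₂ (genD-odd m)) (shift-cong (suc m ℕ.* 2) (proj₁ (genD-odd m))) ⟩
      (P ⊕ shift (suc m ℕ.* 2) 𝟘)      ≈⟨ ⊕-congˡ P (shift-𝟘 (suc m ℕ.* 2)) ⟩
      (P ⊕ 𝟘)                          ≈⟨ ⊕-identityʳ P ⟩
      P                                ∎

  genD-odd : ∀ m → (genD (suc (m ℕ.* 2)) ≈ 𝟘)
                 × (genD′ (suc (m ℕ.* 2)) ≈ poch (⊖ q) (q ^^ 2) (suc m))
  genD-odd m = ℰ-series , 𝒪-series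
    where
    open ≈-Reasoning
    P : FPS
    P = poch (⊖ q) (q ^^ 2) m
    ℰ-series : genD (suc (m ℕ.* 2)) ≈ 𝟘
    ℰ-series = begin
      (genD (m ℕ.* 2) ⊕ (-1ℤ ^ suc (m ℕ.* 2) · genD′ (m ℕ.* 2)))
        ≈⟨ ⊕-cong (proj₁ (genD-even m)) (·-cong (-1ℤ ^ suc (m ℕ.* 2)) (proj₂ (genD-even m))) ⟩
      (P ⊕ (-1ℤ ^ suc (m ℕ.* 2) · P))  ≈⟨ ⊕-congˡ P (·-odd m P) ⟩
      (P ⊕ (⊖ P))                      ≈⟨ ⊕-inverseʳ P ⟩
      𝟘                                ∎
    𝒪-series : genD′ (suc (m ℕ.* 2)) ≈ poch (⊖ q) (q ^^ 2) (suc m)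
    𝒪-series = begin
      (genD′ (m ℕ.* 2) ⊕ shift (suc (m ℕ.* 2)) (genD (m ℕ.* 2)))
        ≈⟨ ⊕-cong (proj₂ (genD-even m)) (shift-cong (suc (m ℕ.* 2)) (proj₁ (genD-even m))) ⟩
      (P ⊕ shift (suc (m ℕ.* 2)) P)    ≈⟨ ≈-sym (poch-−q-q²-suc m) ⟩
      poch (⊖ q) (q ^^ 2) (suc m)      ∎

mutual
  genP-even : ∀ m → (genP (m ℕ.* 2) ≈ genP′ (m ℕ.* 2))
                  × ((genP (m ℕ.* 2) ⊗ poch (q ^^ 2) (q ^^ 2) m) ≈ 𝟙)
  genP-even zero    = ≈-refl , ⊗-identityˡ 𝟙
  genP-even (suc m) = Y≈Y′ , inverse
    where
    open ≈-Reasoning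
    N : ℕ
    N = suc m ℕ.* 2
    B Y Q Z : FPS
    B = genP (m ℕ.* 2)
    Y = genP N
    Q = poch (q ^^ 2) (q ^^ 2) m
    Z = Y ⊗ Q
    Y≈Y′ : Y ≈ genP′ N
    Y≈Y′ = begin
      Y                                              ≈⟨ genP-unfold (suc (m ℕ.* 2)) ⟩
      (genP (suc (m ℕ.* 2)) ⊕ (-1ℤ ^ N · genP′ N))
        ≈⟨ ⊕-cong (proj₁ (genP-odd m)) (·-even (suc m) (genP′ N)) ⟩
      (𝟘 ⊕ genP′ N)                                  ≈⟨ ⊕-identityˡ (genP′ N) ⟩
      genP′ N                                        ∎
    Y≈B+qᴺY : Y ≈ (B ⊕ shift N Y)
    Y≈B+qᴺY = ≈-trans Y≈Y′ (⊕-congʳ (shift N Y) (proj₂ (genP-odd m)))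
    Z≈1+qᴺZ : Z ≈ (𝟙 ⊕ shift N Z)
    Z≈1+qᴺZ = begin
      Y ⊗ Q                            ≈⟨ ⊗-congʳ Q Y≈B+qᴺY ⟩
      (B ⊕ shift N Y) ⊗ Q              ≈⟨ ⊗-distribʳ Q B (shift N Y) ⟩
      ((B ⊗ Q) ⊕ (shift N Y ⊗ Q))      ≈⟨ ⊕-cong (proj₂ (genP-even m)) (⊗-shiftˡ N Y Q) ⟩
      (𝟙 ⊕ shift N Z)                  ∎
    inverse : (Y ⊗ poch (q ^^ 2) (q ^^ 2) (suc m)) ≈ 𝟙
    inverse = begin
      Y ⊗ poch (q ^^ 2) (q ^^ 2) (suc m)   ≈⟨ ⊗-congˡ Y (poch-q²-q²-suc m) ⟩
      Y ⊗ (Q ⊕ (⊖ shift N Q))              ≈⟨ ⊗-distribˡ Y Q (⊖ shift N Q) ⟩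
      (Z ⊕ (Y ⊗ (⊖ shift N Q)))
        ≈⟨ ⊕-congˡ Z (≈-trans (⊗-negʳ Y (shift N Q)) (⊖-cong (⊗-shiftʳ N Y Q))) ⟩
      (Z ⊕ (⊖ shift N Z))                  ≈⟨ ⊕-congʳ (⊖ shift N Z) Z≈1+qᴺZ ⟩
      ((𝟙 ⊕ shift N Z) ⊕ (⊖ shift N Z))    ≈⟨ ⊕-cancelʳ 𝟙 (shift N Z) ⟩
      𝟙                                    ∎

  genP-odd : ∀ m → (genP (suc (m ℕ.* 2)) ≈ 𝟘) × (genP′ (suc (m ℕ.* 2)) ≈ genP (m ℕ.* 2))
  genP-odd m = X≈𝟘 , 𝒪-series
    where
    open ≈-Reasoning
    j : ℕ
    j = suc (m ℕ.* 2)
    B B′ X : FPS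
    B = genP (m ℕ.* 2)
    B′ = genP′ (m ℕ.* 2)
    X = genP j
    Φ : FPS → FPS
    Φ F = ⊖ shift j F
    Φ-causal : Causal Φ
    Φ-causal f g k f≡g = cong -_ (shift-causal (m ℕ.* 2) f g k f≡g)
    X≈ΦX : X ≈ Φ X
    X≈ΦX = begin
      X                                       ≈⟨ genP-unfold (m ℕ.* 2) ⟩
      (B ⊕ (-1ℤ ^ j · (B′ ⊕ shift j X)))      ≈⟨ ⊕-congˡ B (·-odd m (B′ ⊕ shift j X)) ⟩
      (B ⊕ (⊖ (B′ ⊕ shift j X)))
        ≈⟨ ⊕-congˡ B (⊖-cong (⊕-congʳ (shift j X) (≈-sym (proj₁ (genP-even m))))) ⟩
      (B ⊕ (⊖ (B ⊕ shift j X)))               ≈⟨ ⊕-⊖-cancelˡ B (shift j X) ⟩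
      Φ X                                     ∎
    X≈𝟘 : X ≈ 𝟘
    X≈𝟘 = fixpoint-unique Φ-causal X≈ΦX (λ k → cong -_ (sym (shift-𝟘 j k)))
    𝒪-series : genP′ j ≈ B
    𝒪-series = begin
      (B′ ⊕ shift j X)    ≈⟨ ⊕-congˡ B′ (≈-trans (shift-cong j X≈𝟘) (shift-𝟘 j)) ⟩
      (B′ ⊕ 𝟘)            ≈⟨ ⊕-identityʳ B′ ⟩
      B′                  ≈⟨ ≈-sym (proj₁ (genP-even m)) ⟩
      B                   ∎

distinct-even : ∀ m → IsGenFun (InD (m ℕ.* 2)) (poch (⊖ q) (q ^^ 2) m)
distinct-even m = HasGF-resp (proj₁ (genD-even m)) (proj₁ (genD-correct (m ℕ.* 2)))

distinct-odd : ∀ m → IsGenFun (InD (suc (m ℕ.* 2))) 𝟘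
distinct-odd m = HasGF-resp (proj₁ (genD-odd m)) (proj₁ (genD-correct (suc (m ℕ.* 2))))

unrestricted-even : ∀ m →
  Σ FPS (λ f → IsGenFun (InP (m ℕ.* 2)) f × ((f ⊗ poch (q ^^ 2) (q ^^ 2) m) ≈ 𝟙))
unrestricted-even m = genP (m ℕ.* 2) , proj₁ (genP-correct (m ℕ.* 2)) , proj₂ (genP-even m)

unrestricted-odd : ∀ m → IsGenFun (InP (suc (m ℕ.* 2))) 𝟘
unrestricted-odd m = HasGF-resp (proj₁ (genP-odd m)) (proj₁ (genP-correct (suc (m ℕ.* 2))))

even⇒≡half*2 : ∀ N → N % 2 ≡ 0 → N ≡ N / 2 ℕ.* 2
even⇒≡half*2 N N%2≡0 = trans (m≡m%n+[m/n]*n N 2) (cong (ℕ._+ N / 2 ℕ.* 2) N%2≡0)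

odd⇒≡1+half*2 : ∀ N → N % 2 ≡ 1 → N ≡ suc (N / 2 ℕ.* 2)
odd⇒≡1+half*2 N N%2≡1 = trans (m≡m%n+[m/n]*n N 2) (cong (ℕ._+ N / 2 ℕ.* 2) N%2≡1)

theorem5p1 : (N : ℕ) →
    ((N % 2 ≡ 0 → IsGenFun (InD N) (poch (⊖ q) (q ^^ 2) (N / 2)))
      × (N % 2 ≡ 1 → IsGenFun (InD N) 𝟘))
    × ((N % 2 ≡ 0 → Σ FPS (λ f → IsGenFun (InP N) f × ((f ⊗ poch (q ^^ 2) (q ^^ 2) (N / 2)) ≈ 𝟙)))
      × (N % 2 ≡ 1 → IsGenFun (InP N) 𝟘))
theorem5p1 N =
  ( on-even (λ n m → IsGenFun (InD n) (poch (⊖ q) (q ^^ 2) m)) distinct-even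
  , on-odd (λ n → IsGenFun (InD n) 𝟘) distinct-odd )
  , ( on-even (λ n m → Σ FPS (λ f → IsGenFun (InP n) f × ((f ⊗ poch (q ^^ 2) (q ^^ 2) m) ≈ 𝟙)))
        unrestricted-even
    , on-odd (λ n → IsGenFun (InP n) 𝟘) unrestricted-odd )
  where
  on-even : (P : ℕ → ℕ → Set) → (∀ m → P (m ℕ.* 2) m) → N % 2 ≡ 0 → P N (N / 2)
  on-even P p even = subst (λ n → P n (N / 2)) (sym (even⇒≡half*2 N even)) (p (N / 2))
  on-odd : (P : ℕ → Set) → (∀ m → P (suc (m ℕ.* 2))) → N % 2 ≡ 1 → P N
  on-odd P p odd = subst P (sym (odd⇒≡1+half*2 N odd)) (p (N / 2))
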